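{- For every $w\in\check{\mathfrak{H}}^1$ we have $\rho_0(w)=\rho(w)$.
   Context: Let $\mathfrak{H}=\mathbb{Q}\langle x,y\rangle$ be the noncommutative polynomial algebra over $\mathbb{Q}$ in $x,y$; put $z_k=x^{k-1}y$ for $k\ge1$. Let $\check{\mathfrak{H}}^1$ be the $\mathbb{Q}$-span of all monomials $z_{k_1}\cdots z_{k_l}$ with $l\ge1$, $k_i\ge1$, not all $k_i$ equal to $1$. For such a tuple extend indices cyclically ($k_j=k_{j'}$ when $j\equiv j'\pmod l$), and define the $\mathbb{Q}$-linear map $\rho\colon\check{\mathfrak{H}}^1\to\mathfrak{H}$ by \[ \rho(z_{k_1}\cdots z_{k_l})=\sum_{j=1}^{l}\sum_{i=1}^{k_j-1}z_{k_j-i+1}z_{k_{j+1}}\cdots z_{k_{j+l-1}}z_i-\sum_{j=1}^{l}z_{k_j+1}z_{k_{j+1}}\cdots z_{k_{j+l-1}}. \] Make $\mathfrak{H}\otimes\mathfrak{H}$ an $\mathfrak{H}$-bimodule via $a\diamond(w_1\otimes w_2)\diamond b=w_1b\otimes aw_2$. Let $\mathcal{C}_0\colon\mathfrak{H}\to\mathfrak{H}\otimes\mathfrak{H}$ be the $\mathbb{Q}$-linear map with $\mathcal{C}_0(1)=0$, $\mathcal{C}_0(x)=x\otimes y$, $\mathcal{C}_0(y)=-x\otimes y$, $\mathcal{C}_0(ww')=\mathcal{C}_0(w)\diamond w'+w\diamond\mathcal{C}_0(w')$, and let $\rho_0=M_0\circ\mathcal{C}_0$ where $M_0(w_1\otimes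 w_2)=w_1w_2$. -}

module Defs where

open import Data.Nat using (ℕ; zero; suc; _∸_; _≤_)
open import Data.Rational using (ℚ; 0ℚ; 1ℚ; -_; _+_; _*_)
open import Data.List using (List; []; _∷_; _++_; map; foldr; concatMap; replicate; upTo)
open import Data.List.Relation.Unary.All using (All)
open import Data.Product using (_×_; _,_)
open import Relation.Binary.PropositionalEquality using (_≡_; refl)
open import Relation.Nullary using (¬_; yes; no; Dec)
open import Relation.Binary.Definitions using (DecidableEquality)
import Data.List.Properties as LP
import Data.Product.Properties as PP

data Letter : Set where
  x y : Letter

_≟L_ : DecidableEquality Letter
x ≟L x = yes refl
x ≟L y = no λ ()
y ≟L x = no λ ()
y ≟L y = yes refl

Word : Set
Word = List Letter

_≟W_ : DecidableEquality Word
_≟W_ = LP.≡-dec _≟L_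

-- An element of 𝔥 is a formal finite ℚ-linear combination of words.
𝔥 : Set
𝔥 = List (ℚ × Word)

coeff : 𝔥 → Word → ℚ
coeff [] w = 0ℚ
coeff ((c , u) ∷ p) w with u ≟W w
... | yes _ = c + coeff p w
... | no  _ = coeff p w

_≈_ : 𝔥 → 𝔥 → Set
p ≈ q = ∀ w → coeff p w ≡ coeff q w

infix 4 _≈_

0𝔥 : 𝔥
0𝔥 = []

_⊕_ : 𝔥 → 𝔥 → 𝔥
p ⊕ q = p ++ q

_·_ : ℚ → 𝔥 → 𝔥
c · p = map (λ { (d , u) → (c * d , u) }) p

⊖_ : 𝔥 → 𝔥
⊖ p = (- 1ℚ) · p

mono : Word → 𝔥
mono u = (1ℚ , u) ∷ []

𝔥⊗𝔥 : Set
𝔥⊗𝔥 = List (ℚ × (Word × Word))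

_⋄_⋄_ : Word → 𝔥⊗𝔥 → Word → 𝔥⊗𝔥
a ⋄ t ⋄ b = map (λ { (c , (w₁ , w₂)) → (c , (w₁ ++ b , a ++ w₂)) }) t

𝒞₀-letter : Letter → 𝔥⊗𝔥
𝒞₀-letter x = (1ℚ , (x ∷ [] , y ∷ [])) ∷ []
𝒞₀-letter y = (- 1ℚ , (x ∷ [] , y ∷ [])) ∷ []

-- 𝒞₀ on words, via the derivation rule 𝒞₀(a w') = 𝒞₀(a) ⋄ w' + a ⋄ 𝒞₀(w'),
-- with 𝒞₀(1) = 0
𝒞₀-word : Word → 𝔥⊗𝔥
𝒞₀-word [] = []
𝒞₀-word (a ∷ w) = ([] ⋄ 𝒞₀-letter a ⋄ w) ++ ((a ∷ []) ⋄ 𝒞₀-word w ⋄ [])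

𝒞₀ : 𝔥 → 𝔥⊗𝔥
𝒞₀ p = concatMap (λ { (c , u) → map (λ { (d , t) → (c * d , t) }) (𝒞₀-word u) }) p

M₀ : 𝔥⊗𝔥 → 𝔥
M₀ t = map (λ { (c , (w₁ , w₂)) → (c , w₁ ++ w₂) }) t

ρ₀ : 𝔥 → 𝔥
ρ₀ p = M₀ (𝒞₀ p)

z : ℕ → Word
z k = replicate (k ∸ 1) x ++ (y ∷ [])

Z : List ℕ → Word
Z ks = foldr (λ k w → z k ++ w) [] ks

-- index tuples spanning ȟ¹: l ≥ 1, all kᵢ ≥ 1, not all kᵢ = 1
record Admissible (ks : List ℕ) : Set where
  field
    nonempty  : ¬ (ks ≡ [])
    positive  : All (λ k → 1 ≤ k) ks
    notAllOne : ¬ All (λ k → k ≡ 1) ks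

Combo : Set
Combo = List (ℚ × List ℕ)

embed : Combo → 𝔥
embed w = map (λ { (c , ks) → (c , Z ks) }) w

-- cyclic rotations: for (k₁,…,k_l) the list of (k_j , (k_{j+1},…,k_{j+l-1})), j = 1..l
rotations-go : List ℕ → List ℕ → List (ℕ × List ℕ)
rotations-go pre [] = []
rotations-go pre (k ∷ post) = (k , post ++ pre) ∷ rotations-go (pre ++ (k ∷ [])) post

rotations : List ℕ → List (ℕ × List ℕ)
rotations ks = rotations-go [] ks

range1 : ℕ → List ℕ
range1 n = map suc (upTo n)

ρ-mono : List ℕ → 𝔥
ρ-mono ks = concatMap term (rotations ks)
  where
  term : ℕ × List ℕ → 𝔥
  term (kj , rest) =
    concatMap (λ i → mono (z (suc (kj ∸ i)) ++ Z rest ++ z i)) (range1 (kj ∸ 1))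
    ⊕ (⊖ mono (z (suc kj) ++ Z rest))

ρ : Combo → 𝔥
ρ w = concatMap (λ { (c , ks) → c · ρ-mono ks }) w

{-# OPTIONS --safe #-}
-- Since 𝒞₀ is a derivation, ρ₀(a₁⋯aₙ) = Σⱼ sign(aⱼ) x aⱼ₊₁⋯aₙ a₁⋯aⱼ₋₁ y with
-- sign(x) = 1, sign(y) = −1: each letter is deleted, the word is rotated so that it
-- starts just after that letter, and the result is wrapped in x ⋯ y.  For a monomial
-- z_{k₁}⋯z_{k_l} the k_j − 1 letters x of the block z_{k_j} give exactly the positive
-- terms of ρ, and its letter y gives −x z_{k_{j+1}}⋯z_{k_{j+l}}.  The latter run over
-- the same cyclic rotations as the negative terms −x z_{k_j}⋯z_{k_{j+l-1}} of ρ,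
-- shifted by one.  Hence ρ₀(w) and ρ(w) are permutations of one another as lists of
-- terms.
module Submission where

open import Defs
open import Data.Product using (proj₂)
open import Data.List.Relation.Unary.All using (All)

open import Algebra.Bundles using (CommutativeMonoid)
open import Data.Nat using (ℕ; suc; _∸_; _≤_; s≤s)
open import Data.Nat.Properties using (∸-+-assoc)
open import Data.Rational using (ℚ; 0ℚ; 1ℚ; -_; _+_; _*_)
open import Data.Rational.Properties using (+-identityˡ; +-0-commutativeMonoid)
open import Data.List using (List; []; _∷_; _++_; _∷ʳ_; [_]; map; foldr; concatMap; applyUpTo; upTo)
open import Data.List.Properties
  using (++-assoc; ++-identityʳ; map-++; map-∘; map-cong; map-upTo; concatMap-cong; concatMap-map; concatMap-pure)
open import Data.List.Relation.Unary.All using ([]; _∷_)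
open import Data.List.Relation.Binary.Permutation.Propositional
  using (_↭_; ↭-refl; ↭⇒↭ₛ; module PermutationReasoning)
open import Data.List.Relation.Binary.Permutation.Propositional.Properties
  using (map⁺; ++⁺; ++⁺ˡ; shifts; drop-∷; ∷↭∷ʳ)
open import Data.List.Relation.Binary.Permutation.Setoid.Properties using (foldr-commMonoid)
open import Data.Product using (_×_; _,_)
open import Function using (_∘_)
open import Relation.Binary.PropositionalEquality using (_≡_; refl; sym; trans; cong; cong₂; module ≡-Reasoning)
open import Relation.Nullary using (yes; no)

termCoeff : Word → ℚ × Word → ℚ
termCoeff w (c , u) with u ≟W w
... | yes _ = c
... | no  _ = 0ℚ

coeff≡sum : ∀ p w → coeff p w ≡ foldr _+_ 0ℚ (map (termCoeff w) p)
coeff≡sum []            w = refl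
coeff≡sum ((c , u) ∷ p) w with u ≟W w
... | yes _ = cong (c +_) (coeff≡sum p w)
... | no  _ = trans (coeff≡sum p w) (sym (+-identityˡ _))

↭⇒≈ : ∀ {p q : 𝔥} → p ↭ q → p ≈ q
↭⇒≈ {p} {q} p↭q w = begin
  coeff p w                             ≡⟨ coeff≡sum p w ⟩
  foldr _+_ 0ℚ (map (termCoeff w) p)    ≡⟨ foldr-commMonoid ℚ+.setoid ℚ+.isCommutativeMonoid
                                             (↭⇒↭ₛ (map⁺ (termCoeff w) p↭q)) ⟩
  foldr _+_ 0ℚ (map (termCoeff w) q)    ≡⟨ coeff≡sum q w ⟨
  coeff q w                             ∎
  where
  open ≡-Reasoning
  module ℚ+ = CommutativeMonoid +-0-commutativeMonoid

concatMap-[]∘ : ∀ {A B : Set} (f : A → B) xs → concatMap (λ a → [ f a ]) xs ≡ map f xs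
concatMap-[]∘ f xs = trans (sym (concatMap-map [_] f xs)) (concatMap-pure (map f xs))

concatMap-++-↭ : ∀ {A B : Set} (f g : A → List B) xs →
                 concatMap (λ a → f a ++ g a) xs ↭ concatMap f xs ++ concatMap g xs
concatMap-++-↭ f g []       = ↭-refl
concatMap-++-↭ f g (a ∷ xs) = begin
  (f a ++ g a) ++ concatMap (λ a → f a ++ g a) xs  ≡⟨ ++-assoc (f a) (g a) _ ⟩
  f a ++ g a ++ concatMap (λ a → f a ++ g a) xs    ↭⟨ ++⁺ˡ (f a) (++⁺ˡ (g a) (concatMap-++-↭ f g xs)) ⟩
  f a ++ g a ++ concatMap f xs ++ concatMap g xs   ↭⟨ ++⁺ˡ (f a) (shifts (g a) (concatMap f xs)) ⟩
  f a ++ concatMap f xs ++ g a ++ concatMap g xs   ≡⟨ ++-assoc (f a) (concatMap f xs) _ ⟨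
  (f a ++ concatMap f xs) ++ g a ++ concatMap g xs ∎
  where open PermutationReasoning

applyUpTo-cong : ∀ {A : Set} {f g : ℕ → A} → (∀ j → f j ≡ g j) → ∀ n → applyUpTo f n ≡ applyUpTo g n
applyUpTo-cong {f = f} {g} f≗g n =
  trans (sym (map-upTo f n)) (trans (map-cong f≗g (upTo n)) (map-upTo g n))

sign : Letter → ℚ
sign x = 1ℚ
sign y = - 1ℚ

-- The terms of ρ₀(pre ++ u) coming from the letters of u.
ρ₀-terms : Word → Word → 𝔥
ρ₀-terms pre []         = []
ρ₀-terms pre (a ∷ post) = (sign a , x ∷ post ++ pre ++ y ∷ []) ∷ ρ₀-terms (pre ++ [ a ]) post

M₀-mid : Word → 𝔥⊗𝔥 → 𝔥
M₀-mid m = map (λ { (c , (w₁ , w₂)) → (c , w₁ ++ m ++ w₂) })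

M₀≡M₀-mid[] : ∀ t → M₀ t ≡ M₀-mid [] t
M₀≡M₀-mid[] = map-cong λ _ → refl

M₀-mid-⋄ : ∀ m a t → M₀-mid m ([ a ] ⋄ t ⋄ []) ≡ M₀-mid (m ++ [ a ]) t
M₀-mid-⋄ m a t = trans (sym (map-∘ t)) (map-cong move t)
  where
  move : ∀ s → let (c , (w₁ , w₂)) = s in
         (c , (w₁ ++ []) ++ m ++ a ∷ w₂) ≡ (c , w₁ ++ (m ++ [ a ]) ++ w₂)
  move (c , (w₁ , w₂)) =
    cong (c ,_) (cong₂ _++_ (++-identityʳ w₁) (sym (++-assoc m [ a ] w₂)))

M₀-mid-𝒞₀-word : ∀ m u → M₀-mid m (𝒞₀-word u) ≡ ρ₀-terms m u
M₀-mid-𝒞₀-word m []      = refl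
M₀-mid-𝒞₀-word m (a ∷ w) = begin
  M₀-mid m (([] ⋄ 𝒞₀-letter a ⋄ w) ++ ([ a ] ⋄ 𝒞₀-word w ⋄ []))
    ≡⟨ map-++ _ ([] ⋄ 𝒞₀-letter a ⋄ w) _ ⟩
  M₀-mid m ([] ⋄ 𝒞₀-letter a ⋄ w) ++ M₀-mid m ([ a ] ⋄ 𝒞₀-word w ⋄ [])
    ≡⟨ cong₂ _++_ (deleted a) (M₀-mid-⋄ m a (𝒞₀-word w)) ⟩
  [ (sign a , x ∷ w ++ m ++ y ∷ []) ] ++ M₀-mid (m ++ [ a ]) (𝒞₀-word w)
    ≡⟨ cong ((sign a , x ∷ w ++ m ++ y ∷ []) ∷_) (M₀-mid-𝒞₀-word (m ++ [ a ]) w) ⟩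
  ρ₀-terms m (a ∷ w) ∎
  where
  open ≡-Reasoning
  deleted : ∀ a → M₀-mid m ([] ⋄ 𝒞₀-letter a ⋄ w) ≡ [ (sign a , x ∷ w ++ m ++ y ∷ []) ]
  deleted x = refl
  deleted y = refl

M₀∘𝒞₀-word : ∀ u → M₀ (𝒞₀-word u) ≡ ρ₀-terms [] u
M₀∘𝒞₀-word u = trans (M₀≡M₀-mid[] (𝒞₀-word u)) (M₀-mid-𝒞₀-word [] u)

Z-++ : ∀ as bs → Z (as ++ bs) ≡ Z as ++ Z bs
Z-++ []       bs = refl
Z-++ (k ∷ as) bs = trans (cong (z k ++_) (Z-++ as bs)) (sym (++-assoc (z k) (Z as) (Z bs)))

ρ₀-terms-z : ∀ n pre post →
  ρ₀-terms pre (z (suc n) ++ post) ≡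
  applyUpTo (λ j → (1ℚ , z (suc (n ∸ j)) ++ post ++ pre ++ z (suc j))) n ++
  (- 1ℚ , x ∷ post ++ pre ++ z (suc n)) ∷ ρ₀-terms (pre ++ z (suc n)) post
ρ₀-terms-z 0       pre post = refl
ρ₀-terms-z (suc n) pre post =
  cong₂ _∷_ (cong (λ v → (1ℚ , x ∷ v)) (++-assoc (z (suc n)) post (pre ++ y ∷ [])))
    (trans (ρ₀-terms-z n (pre ++ [ x ]) post)
      (cong₂ _++_
        (applyUpTo-cong (λ j → cong (λ v → (1ℚ , z (suc (n ∸ j)) ++ post ++ v)) (snoc (z (suc j)))) n)
        (cong₂ _∷_ (cong (λ v → (- 1ℚ , x ∷ post ++ v)) (snoc (z (suc n))))
                   (cong (λ v → ρ₀-terms v post) (snoc (z (suc n)))))))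
  where
  snoc : ∀ v → (pre ++ [ x ]) ++ v ≡ pre ++ x ∷ v
  snoc = ++-assoc pre [ x ]

-- The terms of ρ and of ρ₀ attached to a rotation (k_j , (k_{j+1}, …, k_{j+l-1})).
ρ⁺ ρ⁻ ρ₀⁻ : ℕ × List ℕ → 𝔥
ρ⁺ (k , rest) = concatMap (λ i → mono (z (suc (k ∸ i)) ++ Z rest ++ z i)) (range1 (k ∸ 1))
ρ⁻ (k , rest) = ⊖ mono (z (suc k) ++ Z rest)
ρ₀⁻ (k , rest) = [ (- 1ℚ , x ∷ Z rest ++ z k) ]

ρ⁺≡applyUpTo : ∀ k rest →
  ρ⁺ (k , rest) ≡ applyUpTo (λ j → (1ℚ , z (suc ((k ∸ 1) ∸ j)) ++ Z rest ++ z (suc j))) (k ∸ 1)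
ρ⁺≡applyUpTo k rest = begin
  concatMap (λ i → [ term i ]) (map suc (upTo (k ∸ 1)))  ≡⟨ concatMap-map _ suc (upTo (k ∸ 1)) ⟩
  concatMap (λ j → [ term (suc j) ]) (upTo (k ∸ 1))      ≡⟨ concatMap-[]∘ (term ∘ suc) (upTo (k ∸ 1)) ⟩
  map (term ∘ suc) (upTo (k ∸ 1))                        ≡⟨ map-upTo (term ∘ suc) (k ∸ 1) ⟩
  applyUpTo (term ∘ suc) (k ∸ 1)                         ≡⟨ applyUpTo-cong reindex (k ∸ 1) ⟩
  applyUpTo (λ j → (1ℚ , z (suc ((k ∸ 1) ∸ j)) ++ Z rest ++ z (suc j))) (k ∸ 1) ∎
  where
  open ≡-Reasoning
  term : ℕ → ℚ × Word
  term i = (1ℚ , z (suc (k ∸ i)) ++ Z rest ++ z i)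
  reindex : ∀ j → term (suc j) ≡ (1ℚ , z (suc ((k ∸ 1) ∸ j)) ++ Z rest ++ z (suc j))
  reindex j = cong (λ m → (1ℚ , z (suc m) ++ Z rest ++ z (suc j))) (sym (∸-+-assoc k 1 j))

ρ₀-terms-Z : ∀ bs ks → ρ₀-terms (Z bs) (Z ks) ≡ concatMap (λ r → ρ⁺ r ++ ρ₀⁻ r) (rotations-go bs ks)
ρ₀-terms-Z bs []       = refl
ρ₀-terms-Z bs (k ∷ ks) = begin
  ρ₀-terms (Z bs) (z (suc (k ∸ 1)) ++ Z ks)
    ≡⟨ ρ₀-terms-z (k ∸ 1) (Z bs) (Z ks) ⟩
  applyUpTo (λ j → (1ℚ , z (suc ((k ∸ 1) ∸ j)) ++ Z ks ++ Z bs ++ z (suc j))) (k ∸ 1) ++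
  (- 1ℚ , x ∷ Z ks ++ Z bs ++ z k) ∷ ρ₀-terms (Z bs ++ z k) (Z ks)
    ≡⟨ cong₂ _++_ positive (cong₂ _∷_ (cong (λ v → (- 1ℚ , x ∷ v)) (Z-++-assoc (z k))) rest) ⟩
  ρ⁺ (k , ks ++ bs) ++ ρ₀⁻ (k , ks ++ bs) ++ concatMap (λ r → ρ⁺ r ++ ρ₀⁻ r) (rotations-go (bs ++ [ k ]) ks)
    ≡⟨ ++-assoc (ρ⁺ (k , ks ++ bs)) _ _ ⟨
  concatMap (λ r → ρ⁺ r ++ ρ₀⁻ r) (rotations-go bs (k ∷ ks)) ∎
  where
  open ≡-Reasoning
  Z-++-assoc : ∀ v → Z ks ++ Z bs ++ v ≡ Z (ks ++ bs) ++ v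
  Z-++-assoc v = trans (sym (++-assoc (Z ks) (Z bs) v)) (cong (_++ v) (sym (Z-++ ks bs)))
  positive : applyUpTo (λ j → (1ℚ , z (suc ((k ∸ 1) ∸ j)) ++ Z ks ++ Z bs ++ z (suc j))) (k ∸ 1)
             ≡ ρ⁺ (k , ks ++ bs)
  positive = trans
    (applyUpTo-cong (λ j → cong (λ v → (1ℚ , z (suc ((k ∸ 1) ∸ j)) ++ v)) (Z-++-assoc (z (suc j)))) (k ∸ 1))
    (sym (ρ⁺≡applyUpTo k (ks ++ bs)))
  rest : ρ₀-terms (Z bs ++ z k) (Z ks) ≡ concatMap (λ r → ρ⁺ r ++ ρ₀⁻ r) (rotations-go (bs ++ [ k ]) ks)
  rest = trans (cong (λ v → ρ₀-terms (Z bs ++ v) (Z ks)) (sym (++-identityʳ (z k))))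
               (trans (cong (λ v → ρ₀-terms v (Z ks)) (sym (Z-++ bs [ k ]))) (ρ₀-terms-Z (bs ++ [ k ]) ks))

rotationFrom rotationAfter : ℕ × List ℕ → List ℕ
rotationFrom  (k , rest) = k ∷ rest
rotationAfter (k , rest) = rest ∷ʳ k

rotations-go-cycle : ∀ pre ks →
  (ks ++ pre) ∷ map rotationAfter (rotations-go pre ks) ≡
  map rotationFrom (rotations-go pre ks) ∷ʳ (pre ++ ks)
rotations-go-cycle pre []         = cong [_] (sym (++-identityʳ pre))
rotations-go-cycle pre (k ∷ post) = cong ((k ∷ post ++ pre) ∷_) (begin
  ((post ++ pre) ∷ʳ k) ∷ map rotationAfter (rotations-go (pre ++ [ k ]) post)
    ≡⟨ cong (_∷ map rotationAfter (rotations-go (pre ++ [ k ]) post)) (++-assoc post pre [ k ]) ⟩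
  (post ++ pre ++ [ k ]) ∷ map rotationAfter (rotations-go (pre ++ [ k ]) post)
    ≡⟨ rotations-go-cycle (pre ++ [ k ]) post ⟩
  map rotationFrom (rotations-go (pre ++ [ k ]) post) ∷ʳ ((pre ++ [ k ]) ++ post)
    ≡⟨ cong (map rotationFrom (rotations-go (pre ++ [ k ]) post) ∷ʳ_) (++-assoc pre [ k ] post) ⟩
  map rotationFrom (rotations-go (pre ++ [ k ]) post) ∷ʳ (pre ++ k ∷ post) ∎)
  where open ≡-Reasoning

rotationAfter↭rotationFrom : ∀ ks → map rotationAfter (rotations ks) ↭ map rotationFrom (rotations ks)
rotationAfter↭rotationFrom ks = drop-∷ (begin
  ks ∷ map rotationAfter (rotations ks)        ≡⟨ cong (_∷ map rotationAfter (rotations ks)) (++-identityʳ ks) ⟨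
  (ks ++ []) ∷ map rotationAfter (rotations ks) ≡⟨ rotations-go-cycle [] ks ⟩
  map rotationFrom (rotations ks) ∷ʳ ks         ↭⟨ ∷↭∷ʳ ks (map rotationFrom (rotations ks)) ⟨
  ks ∷ map rotationFrom (rotations ks)          ∎)
  where open PermutationReasoning

negXZ : List ℕ → ℚ × Word
negXZ ks = (- 1ℚ , x ∷ Z ks)

ρ₀⁻≡negXZ∘rotationAfter : ∀ r → ρ₀⁻ r ≡ [ negXZ (rotationAfter r) ]
ρ₀⁻≡negXZ∘rotationAfter (k , rest) = cong (λ v → [ (- 1ℚ , x ∷ v) ])
  (trans (cong (Z rest ++_) (sym (++-identityʳ (z k)))) (sym (Z-++ rest [ k ])))

-- z_{k+1} = x z_k needs k ≥ 1, since z 0 = z 1 = y.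
ρ⁻≡negXZ∘rotationFrom : ∀ pre ks → All (1 ≤_) ks →
  concatMap ρ⁻ (rotations-go pre ks) ≡ map (negXZ ∘ rotationFrom) (rotations-go pre ks)
ρ⁻≡negXZ∘rotationFrom pre []             []                 = refl
ρ⁻≡negXZ∘rotationFrom pre (suc k ∷ post) (s≤s _ ∷ positive) =
  cong (negXZ (suc k ∷ post ++ pre) ∷_) (ρ⁻≡negXZ∘rotationFrom (pre ++ [ suc k ]) post positive)

ρ₀-mono↭ρ-mono : ∀ ks → All (1 ≤_) ks → M₀ (𝒞₀-word (Z ks)) ↭ ρ-mono ks
ρ₀-mono↭ρ-mono ks positive = begin
  M₀ (𝒞₀-word (Z ks))                                    ≡⟨ M₀∘𝒞₀-word (Z ks) ⟩
  ρ₀-terms [] (Z ks)                                     ≡⟨ ρ₀-terms-Z [] ks ⟩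
  concatMap (λ r → ρ⁺ r ++ ρ₀⁻ r) rots                   ↭⟨ concatMap-++-↭ ρ⁺ ρ₀⁻ rots ⟩
  concatMap ρ⁺ rots ++ concatMap ρ₀⁻ rots                ≡⟨ cong (concatMap ρ⁺ rots ++_) negatives₀ ⟩
  concatMap ρ⁺ rots ++ map negXZ (map rotationAfter rots)
    ↭⟨ ++⁺ˡ (concatMap ρ⁺ rots) (map⁺ negXZ (rotationAfter↭rotationFrom ks)) ⟩
  concatMap ρ⁺ rots ++ map negXZ (map rotationFrom rots) ≡⟨ cong (concatMap ρ⁺ rots ++_) negatives ⟨
  concatMap ρ⁺ rots ++ concatMap ρ⁻ rots                 ↭⟨ concatMap-++-↭ ρ⁺ ρ⁻ rots ⟨
  concatMap (λ r → ρ⁺ r ++ ρ⁻ r) rots                    ≡⟨⟩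
  ρ-mono ks                                              ∎
  where
  open PermutationReasoning
  rots : List (ℕ × List ℕ)
  rots = rotations ks
  negatives₀ : concatMap ρ₀⁻ rots ≡ map negXZ (map rotationAfter rots)
  negatives₀ = trans (concatMap-cong ρ₀⁻≡negXZ∘rotationAfter rots)
                     (trans (concatMap-[]∘ (negXZ ∘ rotationAfter) rots) (map-∘ rots))
  negatives : concatMap ρ⁻ rots ≡ map negXZ (map rotationFrom rots)
  negatives = trans (ρ⁻≡negXZ∘rotationFrom [] ks positive) (map-∘ rots)

ρ₀-embed-∷ : ∀ c ks w → ρ₀ (embed ((c , ks) ∷ w)) ≡ c · M₀ (𝒞₀-word (Z ks)) ++ ρ₀ (embed w)
ρ₀-embed-∷ c ks w = begin
  M₀ (scale (𝒞₀-word (Z ks)) ++ 𝒞₀ (embed w))   ≡⟨ map-++ _ (scale (𝒞₀-word (Z ks))) _ ⟩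
  M₀ (scale (𝒞₀-word (Z ks))) ++ ρ₀ (embed w)   ≡⟨ cong (_++ ρ₀ (embed w)) (M₀∘scale (𝒞₀-word (Z ks))) ⟩
  c · M₀ (𝒞₀-word (Z ks)) ++ ρ₀ (embed w)       ∎
  where
  open ≡-Reasoning
  scale : 𝔥⊗𝔥 → 𝔥⊗𝔥
  scale = map (λ { (d , t) → (c * d , t) })
  M₀∘scale : ∀ t → M₀ (scale t) ≡ c · M₀ t
  M₀∘scale t = trans (sym (map-∘ t)) (trans (map-cong (λ _ → refl) t) (map-∘ t))

-- Of the admissibility conditions only the positivity of the indices is needed.
ρ₀-embed↭ρ : ∀ w → All (λ t → Admissible (proj₂ t)) w → ρ₀ (embed w) ↭ ρ w
ρ₀-embed↭ρ []             []           = ↭-refl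
ρ₀-embed↭ρ ((c , ks) ∷ w) (adm ∷ adms) = begin
  ρ₀ (embed ((c , ks) ∷ w))                 ≡⟨ ρ₀-embed-∷ c ks w ⟩
  c · M₀ (𝒞₀-word (Z ks)) ++ ρ₀ (embed w)
    ↭⟨ ++⁺ (map⁺ _ (ρ₀-mono↭ρ-mono ks (Admissible.positive adm))) (ρ₀-embed↭ρ w adms) ⟩
  c · ρ-mono ks ++ ρ w                      ∎
  where open PermutationReasoning

proposition4p2 : (w : Combo) → All (λ t → Admissible (proj₂ t)) w →
                 ρ₀ (embed w) ≈ ρ w
proposition4p2 w admissible = ↭⇒≈ (ρ₀-embed↭ρ w admissible)
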